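{- Every $Q$-point on $\omega$ is a weak $\mathcal{W}$-ultrafilter; that is, if $\mathcal{U}$ is a $Q$-point, then for every finite-to-one function $f:\omega\to\omega$ there exists $U\in\mathcal{U}$ such that $f[U]\in\mathcal{W}$.
   Context: An ultrafilter $\mathcal{U}$ on $\omega$ is a $Q$-point if for every partition $\{Q_n:n\in\omega\}$ of $\omega$ into finite sets there exists $A\in\mathcal{U}$ with $|A\cap Q_n|\le 1$ for every $n\in\omega$. A set $A\subseteq\omega$ is an AP-set if it contains arithmetic progressions of arbitrary finite length. The van der Waerden ideal $\mathcal{W}$ is the ideal of all subsets of $\omega$ that are not AP-sets. For a tall ideal $\mathcal{I}$ on $\omega$, an ultrafilter $\mathcal{U}$ on $\omega$ is a weak $\mathcal{I}$-ultrafilter if for every finite-to-one function $f:\omega\to\omega$ there exists $U\in\mathcal{U}$ with $f[U]\in\mathcal{I}$. -}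

module Defs where

open import Level using (0ℓ)
open import Data.Nat using (ℕ; _+_; _*_; _<_; _≤_)
open import Data.Product using (Σ; ∃; ∃-syntax; _×_; _,_)
open import Data.Sum using (_⊎_)
open import Data.Empty using (⊥)
open import Relation.Nullary using (¬_)
open import Relation.Binary.PropositionalEquality using (_≡_)

SetOfℕ : Set₁
SetOfℕ = ℕ → Set

_⊆_ : SetOfℕ → SetOfℕ → Set
A ⊆ B = ∀ x → A x → B x

_∩_ : SetOfℕ → SetOfℕ → SetOfℕ
(A ∩ B) x = A x × B x

∅ : SetOfℕ
∅ _ = ⊥

ω : SetOfℕ
ω _ = ℕ

∁ : SetOfℕ → SetOfℕ
∁ A x = ¬ A x

-- A subset of ℕ is finite iff it is bounded.
Finite : SetOfℕ → Set
Finite A = ∃[ b ] (∀ x → A x → x < b)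

image : (ℕ → ℕ) → SetOfℕ → SetOfℕ
image f A y = ∃[ x ] (A x × f x ≡ y)

record IsUltrafilter (𝓤 : SetOfℕ → Set) : Set₁ where
  field
    whole    : 𝓤 ω
    no-empty : ¬ 𝓤 ∅
    upward   : ∀ A B → A ⊆ B → 𝓤 A → 𝓤 B
    meet     : ∀ A B → 𝓤 A → 𝓤 B → 𝓤 (A ∩ B)
    ultra    : ∀ A → 𝓤 A ⊎ 𝓤 (∁ A)

IsFinitePartition : (ℕ → SetOfℕ) → Set
IsFinitePartition Q =
  (∀ x → ∃[ n ] Q n x) ×
  (∀ m n x → Q m x → Q n x → m ≡ n) ×
  (∀ n → Finite (Q n))

AtMostOne : SetOfℕ → Set
AtMostOne A = ∀ x y → A x → A y → x ≡ y

IsQPoint : (SetOfℕ → Set) → Set₁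
IsQPoint 𝓤 =
  IsUltrafilter 𝓤 ×
  (∀ (Q : ℕ → SetOfℕ) → IsFinitePartition Q →
     ∃[ A ] (𝓤 A × (∀ n → AtMostOne (A ∩ Q n))))

IsAPSet : SetOfℕ → Set
IsAPSet A = ∀ L → ∃[ a ] ∃[ d ] (1 ≤ d × (∀ i → i < L → A (a + i * d)))

𝒲 : SetOfℕ → Set
𝒲 A = ¬ IsAPSet A

FiniteToOne : (ℕ → ℕ) → Set
FiniteToOne f = ∀ n → Finite (λ x → f x ≡ n)

IsWeakUltrafilter : (SetOfℕ → Set) → (SetOfℕ → Set) → Set₁
IsWeakUltrafilter 𝓘 𝓤 =
  IsUltrafilter 𝓤 ×
  (∀ (f : ℕ → ℕ) → FiniteToOne f → Σ SetOfℕ λ U → 𝓤 U × 𝓘 (image f U))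

module Submission where

-- Given a finite-to-one f, cut the range of f into the dyadic blocks
-- [2ⁿ - 1, 2ⁿ⁺¹ - 1), i.e. group values v by  block v = ⌊log₂ (1 + v)⌋, and
-- pull these blocks back along f.  Since f is finite-to-one the pulled-back
-- blocks form a partition of ω into finite sets, so the Q-point 𝓤 contains a
-- selector A meeting each of them at most once.  The ultrafilter then also
-- contains the part U of A on which the parity of  block ∘ f  is constant.
-- The image f[U] meets every block at most once and only blocks of one
-- parity, so any two of its elements v < w lie at least two blocks apart,
-- whence 2v < w: f[U] is lacunary.  A lacunary set contains no arithmetic
-- progression of length 3, hence lies in the van der Waerden ideal.

open import Defs
open import Data.Nat using (ℕ; suc; _+_; _*_; _^_; _≤_; _<_; _⊔_; NonZero; s≤s; z≤n; parity)
open import Data.Nat.Properties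
open import Data.Nat.Logarithm using (⌊log₂_⌋; ⌊log₂⌋-mono-≤; ⌊log₂[2*b]⌋≡1+⌊log₂b⌋; ⌊log₂[2^n]⌋≡n)
open import Data.Parity.Base using (Parity; 0ℙ; 1ℙ)
open import Data.Parity.Properties using (p≢p⁻¹; suc-homo-⁻¹)
open import Data.Nat.Solver using (module +-*-Solver)
open import Data.Product using (Σ; ∃-syntax; _×_; _,_; proj₁)
open import Data.Sum using (inj₁; inj₂)
open import Relation.Nullary using (¬_; contradiction)
open import Relation.Binary using (tri<; tri≈; tri>)
open import Relation.Binary.PropositionalEquality using (_≡_; refl; sym; trans; cong; subst)

open +-*-Solver using (solve; _:+_; _:*_; _:=_; con)

⌊log₂⌋<⇒< : ∀ {m n} → ⌊log₂ m ⌋ < ⌊log₂ n ⌋ → m < n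
⌊log₂⌋<⇒< lt = ≰⇒> (λ n≤m → <⇒≱ lt (⌊log₂⌋-mono-≤ n≤m))

⌊log₂⌋<⇒<2^ : ∀ m k → ⌊log₂ m ⌋ < k → m < 2 ^ k
⌊log₂⌋<⇒<2^ m k lt = ≰⇒> λ 2^k≤m →
  <⇒≱ lt (subst (_≤ ⌊log₂ m ⌋) (⌊log₂[2^n]⌋≡n k) (⌊log₂⌋-mono-≤ 2^k≤m))

⌊log₂⌋-gap : ∀ m n .{{_ : NonZero m}} → 1 + ⌊log₂ m ⌋ < ⌊log₂ n ⌋ → 2 * m < n
⌊log₂⌋-gap m n lt = ≰⇒> λ n≤2m →
  <⇒≱ lt (subst (⌊log₂ n ⌋ ≤_) (⌊log₂[2*b]⌋≡1+⌊log₂b⌋ m) (⌊log₂⌋-mono-≤ n≤2m))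

block : ℕ → ℕ
block v = ⌊log₂ suc v ⌋

block-bound : ∀ v → v < 2 ^ suc (block v)
block-bound v = <-trans (n<1+n v) (⌊log₂⌋<⇒<2^ (suc v) (suc (block v)) (n<1+n (block v)))

block-gap : ∀ v w → 2 + block v ≤ block w → 2 * v < w
block-gap v w le = <-≤-trans (*-monoʳ-< 2 (n<1+n v)) (≤-pred lt)
  where
  lt : 2 * suc v < suc w
  lt = ⌊log₂⌋-gap (suc v) (suc w) le

sameParity⇒2+≤ : ∀ m n → m < n → parity m ≡ parity n → 2 + m ≤ n
sameParity⇒2+≤ m n m<n eq with m≤n⇒m<n∨m≡n m<n
... | inj₁ 1+m<n = 1+m<n
... | inj₂ refl  = contradiction (trans eq (sym (suc-homo-⁻¹ (suc m)))) (p≢p⁻¹ _)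

Lacunary : SetOfℕ → Set
Lacunary S = ∀ v w → S v → S w → v < w → 2 * v < w

-- A lacunary set contains no 3-term arithmetic progression: the terms
-- a + d < a + 2d would violate 2(a + d) < a + 2d.
lacunary⇒𝒲 : ∀ S → Lacunary S → 𝒲 S
lacunary⇒𝒲 S lac isAP with isAP 3
... | a , d , 1≤d , ap = <⇒≱ doubled (subst (a + 2 * d ≤_) (sym double-second) (m≤n+m _ a))
  where
  second-third : a + 2 * d ≡ (a + 1 * d) + d
  second-third = solve 2 (λ a d → a :+ con 2 :* d := (a :+ con 1 :* d) :+ d) refl a d

  double-second : 2 * (a + 1 * d) ≡ a + (a + 2 * d)
  double-second = solve 2 (λ a d → con 2 :* (a :+ con 1 :* d) := a :+ (a :+ con 2 :* d)) refl a d

  doubled : 2 * (a + 1 * d) < a + 2 * d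
  doubled = lac _ _ (ap 1 (s≤s (s≤s z≤n))) (ap 2 (s≤s (s≤s (s≤s z≤n))))
              (subst (a + 1 * d <_) (sym second-third) (m<m+n (a + 1 * d) 1≤d))

-- A set meeting every block at most once, and only blocks of one parity,
-- is lacunary: two of its elements lie at least two blocks apart.
blockSparse⇒lacunary : ∀ S (p : Parity) →
  (∀ v w → S v → S w → block v ≡ block w → v ≡ w) →
  (∀ v → S v → parity (block v) ≡ p) →
  Lacunary S
blockSparse⇒lacunary S p oneBlock onePar v w Sv Sw v<w with <-cmp (block v) (block w)
... | tri< lt _ _ = block-gap v w (sameParity⇒2+≤ _ _ lt (trans (onePar v Sv) (sym (onePar w Sw))))
... | tri≈ _ eq _ = contradiction (oneBlock v w Sv Sw eq) (<⇒≢ v<w)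
... | tri> _ _ gt = contradiction v<w (<⇒≯ (≤-pred (⌊log₂⌋<⇒< gt)))

-- Under a finite-to-one map the preimage of an initial segment {y < m} is
-- finite, being a finite union of finite fibres.
finiteToOne-preimage : ∀ f → FiniteToOne f → ∀ m → Finite (λ x → f x < m)
finiteToOne-preimage f fto 0       = 0 , λ x ()
finiteToOne-preimage f fto (suc m) with finiteToOne-preimage f fto m | fto m
... | b , below-b | c , fibre-below-c = b ⊔ c , bound
  where
  bound : ∀ x → f x < suc m → x < b ⊔ c
  bound x fx<1+m with m≤n⇒m<n∨m≡n (≤-pred fx<1+m)
  ... | inj₁ fx<m = <-≤-trans (below-b x fx<m) (m≤m⊔n b c)
  ... | inj₂ fx≡m = <-≤-trans (fibre-below-c x fx≡m) (m≤n⊔m b c)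

blockPartition : (ℕ → ℕ) → ℕ → SetOfℕ
blockPartition f n x = block (f x) ≡ n

-- For finite-to-one f they partition ω into finite sets: the n-th lies in
-- the preimage of {y < 2ⁿ⁺¹}.
blockPartition-isFinite : ∀ f → FiniteToOne f → IsFinitePartition (blockPartition f)
blockPartition-isFinite f fto = (λ x → block (f x) , refl) , (λ m n x p q → trans (sym p) q) , finite
  where
  finite : ∀ n → Finite (blockPartition f n)
  finite n with finiteToOne-preimage f fto (2 ^ suc n)
  ... | b , below-b = b , λ x eq → below-b x (subst (λ k → f x < 2 ^ suc k) eq (block-bound (f x)))

ultrafilter-monochromatic : ∀ 𝓤 → IsUltrafilter 𝓤 → (c : ℕ → Parity) → ∃[ p ] 𝓤 (λ x → c x ≡ p)
ultrafilter-monochromatic 𝓤 isUltra c with ultra (λ x → c x ≡ 0ℙ)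
  where open IsUltrafilter isUltra
... | inj₁ class0 = 0ℙ , class0
... | inj₂ notClass0 = 1ℙ , upward _ _ (λ x → ≢0ℙ⇒≡1ℙ (c x)) notClass0
  where
  open IsUltrafilter isUltra
  ≢0ℙ⇒≡1ℙ : ∀ q → ¬ q ≡ 0ℙ → q ≡ 1ℙ
  ≢0ℙ⇒≡1ℙ 0ℙ q≢0ℙ = contradiction refl q≢0ℙ
  ≢0ℙ⇒≡1ℙ 1ℙ _    = refl

selector-image : ∀ (f g : ℕ → ℕ) A → (∀ n → AtMostOne (A ∩ (λ x → g (f x) ≡ n))) →
  ∀ B → B ⊆ A → ∀ v w → image f B v → image f B w → g v ≡ g w → v ≡ w
selector-image f g A selects B B⊆A _ _ (x , Bx , refl) (y , By , refl) gfx≡gfy =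
  cong f (selects (g (f x)) x y (B⊆A x Bx , refl) (B⊆A y By , sym gfx≡gfy))

proposition2p1 : (𝓤 : SetOfℕ → Set) → IsQPoint 𝓤 → IsWeakUltrafilter 𝒲 𝓤
proposition2p1 𝓤 (isUltra , qPoint) = isUltra , weak
  where
  open IsUltrafilter isUltra using (meet)

  weak : (f : ℕ → ℕ) → FiniteToOne f → Σ SetOfℕ λ U → 𝓤 U × 𝒲 (image f U)
  weak f fto with qPoint (blockPartition f) (blockPartition-isFinite f fto)
                | ultrafilter-monochromatic 𝓤 isUltra (λ x → parity (block (f x)))
  ... | A , A∈𝓤 , selects | p , C∈𝓤 =
    U , meet A C A∈𝓤 C∈𝓤 , lacunary⇒𝒲 (image f U) (blockSparse⇒lacunary _ p oneBlock onePar)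
    where
    C U : SetOfℕ
    C x = parity (block (f x)) ≡ p
    U   = A ∩ C

    oneBlock : ∀ v w → image f U v → image f U w → block v ≡ block w → v ≡ w
    oneBlock = selector-image f block A selects U (λ x → proj₁)

    onePar : ∀ v → image f U v → parity (block v) ≡ p
    onePar _ (x , (_ , Cx) , refl) = Cx
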